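{- Let $t\geq 4$ be an even integer and $n\geq 1$ an integer. Then there exists a balanced $\left(\frac{t}{2}\right)^n$-coloring of $C_t^n$ that contains no rainbow geometric line.
   Context: For positive integers $t,n$, $C_t^n=\{x_1x_2\cdots x_n : x_i\in\{0,1,\dots,t-1\}\}$ is the set of ordered $n$-tuples over the alphabet $\{0,\dots,t-1\}$. A geometric line in $C_t^n$ is a sequence of $t$ distinct points $\mathbf{x}_0,\mathbf{x}_1,\dots,\mathbf{x}_{t-1}$, $\mathbf{x}_i=x_{i1}x_{i2}\cdots x_{in}$, such that for each coordinate $j\in\{1,\dots,n\}$ one of the following holds: (1) $x_{0j}=x_{1j}=\cdots=x_{t-1,j}$; (2) $x_{ij}=i$ for every $0\le i\le t-1$; (3) $x_{ij}=t-1-i$ for every $0\le i\le t-1$. A $k$-coloring of $C_t^n$ is a surjective map $f:C_t^n\to\{0,\dots,k-1\}$; it is balanced if all color classes $f^{ -1}(s)$ have the same cardinality. A geometric line is rainbow if its $t$ points receive pairwise distinct colors. -}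

module Defs where

open import Data.Nat using (ℕ; zero; suc; _^_; _/_; _≥_; _*_)
open import Data.Fin using (Fin; opposite)
open import Data.Fin.Properties using (_≟_)
open import Data.Vec using (Vec; []; _∷_; lookup; map)
open import Data.List using (List; []; _∷_; allFin; concatMap; length; filter)
import Data.List as L
open import Data.Product using (Σ; ∃; _×_)
open import Relation.Binary.PropositionalEquality using (_≡_)
open import Function.Definitions using (Injective; Surjective)

-- C_t^n : ordered n-tuples over the alphabet {0,…,t-1}
Point : ℕ → ℕ → Set
Point t n = Vec (Fin t) n

-- explicit enumeration of all points of C_t^n (a list of length t^n, no repeats)
allPoints : (t n : ℕ) → List (Point t n)
allPoints t zero = [] ∷ []
allPoints t (suc n) = concatMap (λ a → L.map (a ∷_) (allPoints t n)) (allFin t)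

IsColoring : (t n k : ℕ) → (Point t n → Fin k) → Set
IsColoring t n k f = Surjective _≡_ _≡_ f

classSize : {t n k : ℕ} → (Point t n → Fin k) → Fin k → ℕ
classSize {t} {n} f s = length (filter (λ x → f x ≟ s) (allPoints t n))

Balanced : {t n k : ℕ} → (Point t n → Fin k) → Set
Balanced {k = k} f = (s s' : Fin k) → classSize f s ≡ classSize f s'

-- the behaviour of one coordinate along a geometric line
data CoordType (t : ℕ) : Set where
  const : Fin t → CoordType t
  up    : CoordType t
  down  : CoordType t

coordAt : {t : ℕ} → CoordType t → Fin t → Fin t
coordAt (const c) i = c
coordAt up        i = i
coordAt down      i = opposite i

LineTemplate : ℕ → ℕ → Set
LineTemplate t n = Vec (CoordType t) n

linePoint : {t n : ℕ} → LineTemplate t n → Fin t → Point t n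
linePoint L i = map (λ τ → coordAt τ i) L

IsGeometricLine : {t n : ℕ} → LineTemplate t n → Set
IsGeometricLine L = Injective _≡_ _≡_ (linePoint L)

Rainbow : {t n k : ℕ} → (Point t n → Fin k) → LineTemplate t n → Set
Rainbow f L = Injective _≡_ _≡_ (λ i → f (linePoint L i))

-- Fold the alphabet in half by identifying a with t-1-a, and colour a point by its folded word
-- over {0,…,t/2-1}, read as a number in base t/2. Every colour class is a product of n
-- two-element fibres, so it has 2^n points. Along any line each coordinate is constant or is
-- i ↦ i or i ↦ t-1-i, so the points x_i and x_{t-1-i} fold to the same word; as t is even,
-- i ≠ t-1-i, so no line (geometric or not) is rainbow.
module Submission where

open import Defs
open import Data.Nat using (ℕ; zero; suc; _+_; _∸_; _*_; _^_; _<_; _≤_; _≥_; _⊓_; _<?_)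
import Data.Nat.Properties as ℕ
open import Data.Fin using (Fin; opposite; toℕ; fromℕ<; inject≤)
import Data.Fin.Properties as Fin
open import Data.Vec using (Vec; []; _∷_; head; tail)
import Data.Vec as Vec
import Data.Vec.Properties as Vec
open import Data.Vec.Recursive using (Fin[m^n]↔Fin[m]^n)
open import Data.Vec.Recursive.Properties using (↔Vec)
open import Data.List using (List; []; _∷_; _++_; length; filter; allFin; tabulate; concatMap)
import Data.List as List
import Data.List.Properties as List
import Data.List.Relation.Unary.All as All
open import Data.Product using (Σ; _×_; _,_; proj₁; proj₂; uncurry)
open import Data.Sum using (_⊎_; inj₁; inj₂)
open import Function using (_∘_)
open import Function.Bundles using (Inverse; _↔_)
open import Function.Properties.Inverse using (↔-trans)
open import Function.Consequences.Propositional using (strictlySurjective⇒surjective)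
open import Level using (Level)
open import Relation.Binary.Definitions using (DecidableEquality)
open import Relation.Binary.PropositionalEquality
  using (_≡_; _≢_; refl; sym; trans; cong; cong₂; subst; module ≡-Reasoning)
open import Relation.Nullary using (¬_; yes; no; contradiction)
open import Relation.Nullary.Decidable using (_×-dec_; _⊎-dec_)
open import Relation.Unary using (Pred; Decidable; _≐_)

private
  variable
    ℓ p q : Level
    A B : Set ℓ

count : {P : Pred A p} → Decidable P → List A → ℕ
count P? xs = length (filter P? xs)

module _ {P : Pred A p} (P? : Decidable P) where

  count-++ : ∀ xs ys → count P? (xs ++ ys) ≡ count P? xs + count P? ys
  count-++ xs ys = trans (cong length (List.filter-++ P? xs ys)) (List.length-++ (filter P? xs))

  count-none : (∀ x → ¬ P x) → ∀ xs → count P? xs ≡ 0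
  count-none ¬P xs = cong length (List.filter-none P? (All.universal ¬P xs))

  count-map : (f : B → A) → ∀ xs → count P? (List.map f xs) ≡ count (P? ∘ f) xs
  count-map f [] = refl
  count-map f (x ∷ xs) with P? (f x)
  ... | yes _ = cong suc (count-map f xs)
  ... | no _  = count-map f xs

module _ {P : Pred A p} {Q : Pred A q} (P? : Decidable P) (Q? : Decidable Q) where

  count-≐ : P ≐ Q → ∀ xs → count P? xs ≡ count Q? xs
  count-≐ P≐Q xs = cong length (List.filter-≐ P? Q? P≐Q xs)

  count-⊎ : (∀ {x} → P x → ¬ Q x) → ∀ xs →
            count (λ x → P? x ⊎-dec Q? x) xs ≡ count P? xs + count Q? xs
  count-⊎ P⇒¬Q [] = refl
  count-⊎ P⇒¬Q (x ∷ xs) with P? x | Q? x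
  ... | yes px | yes qx = contradiction qx (P⇒¬Q px)
  ... | yes _  | no _   = cong suc (count-⊎ P⇒¬Q xs)
  ... | no _   | yes _  = trans (cong suc (count-⊎ P⇒¬Q xs)) (sym (ℕ.+-suc _ _))
  ... | no _   | no _   = count-⊎ P⇒¬Q xs

count-tabulate-suc : ∀ {n} (j : Fin (suc n)) →
                     count (Fin._≟ j) (tabulate Fin.suc) ≡ count (λ i → Fin.suc i Fin.≟ j) (allFin n)
count-tabulate-suc {n} j =
  trans (cong (count (Fin._≟ j)) (sym (List.map-tabulate (λ i → i) Fin.suc)))
        (count-map (Fin._≟ j) Fin.suc (allFin n))

count-≡-allFin : ∀ {n} (j : Fin n) → count (Fin._≟ j) (allFin n) ≡ 1
count-≡-allFin {suc n} Fin.zero =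
  cong suc (trans (count-tabulate-suc {n} Fin.zero) (count-none _ (λ i ()) (allFin n)))
count-≡-allFin {suc n} (Fin.suc j) = begin
  count (Fin._≟ Fin.suc j) (tabulate Fin.suc)         ≡⟨ count-tabulate-suc (Fin.suc j) ⟩
  count (λ i → Fin.suc i Fin.≟ Fin.suc j) (allFin n)  ≡⟨ count-≐ _ (Fin._≟ j) (Fin.suc-injective , cong Fin.suc) (allFin n) ⟩
  count (Fin._≟ j) (allFin n)                         ≡⟨ count-≡-allFin j ⟩
  1                                                   ∎
  where open ≡-Reasoning

module _ {n} {P : Pred A p} {Q : Pred (Vec A n) q} (P? : Decidable P) (Q? : Decidable Q) where

  private
    count-concatMap-∷-step : ∀ x xs ys →
      count (λ v → P? x ×-dec Q? v) ys + count P? xs * count Q? ys ≡ count P? (x ∷ xs) * count Q? ys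
    count-concatMap-∷-step x xs ys with P? x
    ... | yes px = cong (_+ count P? xs * count Q? ys) (count-≐ _ Q? (proj₂ , (px ,_)) ys)
    ... | no ¬px = cong (_+ count P? xs * count Q? ys) (count-none _ (λ _ → ¬px ∘ proj₁) ys)

  count-concatMap-∷ : ∀ xs ys →
    count (λ v → P? (head v) ×-dec Q? (tail v)) (concatMap (λ x → List.map (x ∷_) ys) xs) ≡
    count P? xs * count Q? ys
  count-concatMap-∷ [] ys = refl
  count-concatMap-∷ (x ∷ xs) ys = begin
    count S (List.map (x ∷_) ys ++ concatMap (λ x → List.map (x ∷_) ys) xs)
      ≡⟨ count-++ S (List.map (x ∷_) ys) _ ⟩
    count S (List.map (x ∷_) ys) + count S (concatMap (λ x → List.map (x ∷_) ys) xs)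
      ≡⟨ cong₂ _+_ (count-map S (x ∷_) ys) (count-concatMap-∷ xs ys) ⟩
    count (λ v → P? x ×-dec Q? v) ys + count P? xs * count Q? ys
      ≡⟨ count-concatMap-∷-step x xs ys ⟩
    count P? (x ∷ xs) * count Q? ys
      ∎
    where
    open ≡-Reasoning
    S : Decidable λ v → P (head v) × Q (tail v)
    S v = P? (head v) ×-dec Q? (tail v)

module _ (_≟_ : DecidableEquality B) where

  private
    _≟ⁿ_ : ∀ {n} → DecidableEquality (Vec B n)
    _≟ⁿ_ = Vec.≡-dec _≟_

  count-map-allPoints : ∀ {t d} (h : Fin t → B) → (∀ b → count (λ a → h a ≟ b) (allFin t) ≡ d) →
                        ∀ n (w : Vec B n) → count (λ v → Vec.map h v ≟ⁿ w) (allPoints t n) ≡ d ^ n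
  count-map-allPoints h fibre zero [] = refl
  count-map-allPoints {t} {d} h fibre (suc n) (b ∷ w) = begin
    count (λ v → Vec.map h v ≟ⁿ (b ∷ w)) (allPoints t (suc n))
      ≡⟨ count-≐ _ (λ v → (h (head v) ≟ b) ×-dec (Vec.map h (tail v) ≟ⁿ w)) map-≡-∷ (allPoints t (suc n)) ⟩
    count (λ v → (h (head v) ≟ b) ×-dec (Vec.map h (tail v) ≟ⁿ w)) (allPoints t (suc n))
      ≡⟨ count-concatMap-∷ (λ a → h a ≟ b) (λ v → Vec.map h v ≟ⁿ w) (allFin t) (allPoints t n) ⟩
    count (λ a → h a ≟ b) (allFin t) * count (λ v → Vec.map h v ≟ⁿ w) (allPoints t n)
      ≡⟨ cong₂ _*_ (fibre b) (count-map-allPoints h fibre n w) ⟩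
    d * d ^ n
      ∎
    where
    open ≡-Reasoning
    map-≡-∷ : (λ v → Vec.map h v ≡ b ∷ w) ≐ (λ v → h (head v) ≡ b × Vec.map h (tail v) ≡ w)
    map-≡-∷ = (λ { {_ ∷ _} → Vec.∷-injective }) , (λ { {_ ∷ _} → uncurry (cong₂ _∷_) })

module _ {m x y : ℕ} (x+y≡2m-1 : suc (x + y) ≡ m + m) where
  open ℕ.≤-Reasoning

  <-half⇒≥-half : x < m → m ≤ y
  <-half⇒≥-half x<m = ℕ.+-cancelˡ-≤ m m y (begin
    m + m        ≡⟨ x+y≡2m-1 ⟨
    suc x + y    ≤⟨ ℕ.+-monoˡ-≤ y x<m ⟩
    m + y        ∎)

  ≥-half⇒<-half : m ≤ x → y < m
  ≥-half⇒<-half m≤x = ℕ.+-cancelˡ-≤ m (suc y) m (begin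
    m + suc y    ≤⟨ ℕ.+-monoˡ-≤ (suc y) m≤x ⟩
    x + suc y    ≡⟨ ℕ.+-suc x y ⟩
    suc (x + y)  ≡⟨ x+y≡2m-1 ⟩
    m + m        ∎)

toℕ-+-opposite : ∀ {n} (i : Fin n) → suc (toℕ i + toℕ (opposite i)) ≡ n
toℕ-+-opposite {n} i = begin
  suc (toℕ i + toℕ (opposite i))   ≡⟨ cong (λ k → suc (toℕ i + k)) (Fin.opposite-prop i) ⟩
  suc (toℕ i) + (n ∸ suc (toℕ i))  ≡⟨ ℕ.m+[n∸m]≡n (Fin.toℕ<n i) ⟩
  n                                ∎
  where open ≡-Reasoning

opposite-≢ : ∀ {m} (a : Fin (2 * m)) → opposite a ≢ a
opposite-≢ {m} a opp≡a = ℕ.even≢odd m (toℕ a) (begin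
  2 * m                           ≡⟨ toℕ-+-opposite a ⟨
  suc (toℕ a + toℕ (opposite a))  ≡⟨ cong (λ b → suc (toℕ a + toℕ b)) opp≡a ⟩
  suc (toℕ a + toℕ a)             ≡⟨ cong (λ k → suc (toℕ a + k)) (ℕ.+-identityʳ (toℕ a)) ⟨
  suc (2 * toℕ a)                 ∎)
  where open ≡-Reasoning

module _ {t} (h : Fin t → B) (h-opposite : ∀ a → h (opposite a) ≡ h a) where

  coordAt-opposite : ∀ τ i → h (coordAt τ (opposite i)) ≡ h (coordAt τ i)
  coordAt-opposite (const c) i = refl
  coordAt-opposite up        i = h-opposite i
  coordAt-opposite down      i = h-opposite (opposite i)

  map-linePoint-opposite : ∀ {n} (L : LineTemplate t n) i →
                           Vec.map h (linePoint L (opposite i)) ≡ Vec.map h (linePoint L i)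
  map-linePoint-opposite []      i = refl
  map-linePoint-opposite (τ ∷ L) i = cong₂ _∷_ (coordAt-opposite τ i) (map-linePoint-opposite L i)

module Fold (m : ℕ) where

  private
    toℕ-+-opposite-2m : (a : Fin (2 * m)) → suc (toℕ a + toℕ (opposite a)) ≡ m + m
    toℕ-+-opposite-2m a = trans (toℕ-+-opposite a) (cong (m +_) (ℕ.+-identityʳ m))

    min<m : (a : Fin (2 * m)) → toℕ a ⊓ toℕ (opposite a) < m
    min<m a with toℕ a <? m
    ... | yes a<m = ℕ.m<n⇒m⊓o<n _ a<m
    ... | no a≮m  = ℕ.m<n⇒o⊓m<n _ (≥-half⇒<-half (toℕ-+-opposite-2m a) (ℕ.≮⇒≥ a≮m))

  fold : Fin (2 * m) → Fin m
  fold a = fromℕ< (min<m a)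

  lift : Fin m → Fin (2 * m)
  lift c = inject≤ c (ℕ.m≤m+n m (m + 0))

  toℕ-fold : ∀ a → toℕ (fold a) ≡ toℕ a ⊓ toℕ (opposite a)
  toℕ-fold a = Fin.toℕ-fromℕ< (min<m a)

  toℕ-lift : ∀ c → toℕ (lift c) ≡ toℕ c
  toℕ-lift c = Fin.toℕ-inject≤ c _

  fold-opposite : ∀ a → fold (opposite a) ≡ fold a
  fold-opposite a = Fin.toℕ-injective (begin
    toℕ (fold (opposite a))                         ≡⟨ toℕ-fold (opposite a) ⟩
    toℕ (opposite a) ⊓ toℕ (opposite (opposite a))  ≡⟨ cong (λ b → toℕ (opposite a) ⊓ toℕ b) (Fin.opposite-involutive a) ⟩
    toℕ (opposite a) ⊓ toℕ a                        ≡⟨ ℕ.⊓-comm _ _ ⟩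
    toℕ a ⊓ toℕ (opposite a)                        ≡⟨ toℕ-fold a ⟨
    toℕ (fold a)                                    ∎)
    where open ≡-Reasoning

  fold-lift : ∀ c → fold (lift c) ≡ c
  fold-lift c = Fin.toℕ-injective (begin
    toℕ (fold (lift c))                     ≡⟨ toℕ-fold (lift c) ⟩
    toℕ (lift c) ⊓ toℕ (opposite (lift c))  ≡⟨ ℕ.m≤n⇒m⊓n≡m (ℕ.≤-trans (ℕ.<⇒≤ lift<m) m≤opposite) ⟩
    toℕ (lift c)                            ≡⟨ toℕ-lift c ⟩
    toℕ c                                   ∎)
    where
    open ≡-Reasoning
    lift<m : toℕ (lift c) < m
    lift<m = subst (_< m) (sym (toℕ-lift c)) (Fin.toℕ<n c)
    m≤opposite : m ≤ toℕ (opposite (lift c))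
    m≤opposite = <-half⇒≥-half (toℕ-+-opposite-2m (lift c)) lift<m

  lift-fold : ∀ a → lift (fold a) ≡ a ⊎ lift (fold a) ≡ opposite a
  lift-fold a with ℕ.⊓-sel (toℕ a) (toℕ (opposite a))
  ... | inj₁ min≡a   = inj₁ (Fin.toℕ-injective (trans (toℕ-lift (fold a)) (trans (toℕ-fold a) min≡a)))
  ... | inj₂ min≡opp = inj₂ (Fin.toℕ-injective (trans (toℕ-lift (fold a)) (trans (toℕ-fold a) min≡opp)))

  fold-fibre : ∀ c → (λ a → fold a ≡ c) ≐ (λ a → a ≡ lift c ⊎ a ≡ opposite (lift c))
  fold-fibre c = fibre⊆ , fibre⊇
    where
    fibre⊆ : ∀ {a} → fold a ≡ c → a ≡ lift c ⊎ a ≡ opposite (lift c)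
    fibre⊆ {a} refl with lift-fold a
    ... | inj₁ lift≡a   = inj₁ (sym lift≡a)
    ... | inj₂ lift≡opp = inj₂ (trans (sym (Fin.opposite-involutive a)) (cong opposite (sym lift≡opp)))
    fibre⊇ : ∀ {a} → a ≡ lift c ⊎ a ≡ opposite (lift c) → fold a ≡ c
    fibre⊇ (inj₁ refl) = fold-lift c
    fibre⊇ (inj₂ refl) = trans (fold-opposite (lift c)) (fold-lift c)

  count-fold : ∀ c → count (λ a → fold a Fin.≟ c) (allFin (2 * m)) ≡ 2
  count-fold c = begin
    count (λ a → fold a Fin.≟ c) (allFin (2 * m))
      ≡⟨ count-≐ _ (λ a → (a Fin.≟ lift c) ⊎-dec (a Fin.≟ opposite (lift c))) (fold-fibre c) (allFin (2 * m)) ⟩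
    count (λ a → (a Fin.≟ lift c) ⊎-dec (a Fin.≟ opposite (lift c))) (allFin (2 * m))
      ≡⟨ count-⊎ (Fin._≟ lift c) (Fin._≟ opposite (lift c)) (λ { refl e → opposite-≢ {m} (lift c) (sym e) }) (allFin (2 * m)) ⟩
    count (Fin._≟ lift c) (allFin (2 * m)) + count (Fin._≟ opposite (lift c)) (allFin (2 * m))
      ≡⟨ cong₂ _+_ (count-≡-allFin (lift c)) (count-≡-allFin (opposite (lift c))) ⟩
    2
      ∎
    where open ≡-Reasoning

module FoldColouring (m : ℕ) where
  open Fold m

  digits : ∀ n → Fin (m ^ n) ↔ Vec (Fin m) n
  digits n = ↔-trans (Fin[m^n]↔Fin[m]^n m n) (↔Vec n)

  colouring : ∀ {n} → Point (2 * m) n → Fin (m ^ n)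
  colouring {n} x = Inverse.from (digits n) (Vec.map fold x)

  map-fold-lift : ∀ {n} (w : Vec (Fin m) n) → Vec.map fold (Vec.map lift w) ≡ w
  map-fold-lift []      = refl
  map-fold-lift (c ∷ w) = cong₂ _∷_ (fold-lift c) (map-fold-lift w)

  colouring-surjective : ∀ n → IsColoring (2 * m) n (m ^ n) colouring
  colouring-surjective n = strictlySurjective⇒surjective λ s →
    Vec.map lift (to s) , trans (cong from (map-fold-lift (to s))) (strictlyInverseʳ s)
    where open Inverse (digits n)

  colouring-classSize : ∀ n s → classSize {2 * m} {n} colouring s ≡ 2 ^ n
  colouring-classSize n s = begin
    count (λ x → colouring x Fin.≟ s) (allPoints (2 * m) n)
      ≡⟨ count-≐ _ (λ x → Vec.≡-dec Fin._≟_ (Vec.map fold x) (to s)) class≐fibre (allPoints (2 * m) n) ⟩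
    count (λ x → Vec.≡-dec Fin._≟_ (Vec.map fold x) (to s)) (allPoints (2 * m) n)
      ≡⟨ count-map-allPoints Fin._≟_ fold count-fold n (to s) ⟩
    2 ^ n
      ∎
    where
    open ≡-Reasoning
    open Inverse (digits n)
    class≐fibre : (λ x → colouring x ≡ s) ≐ (λ x → Vec.map fold x ≡ to s)
    class≐fibre = (λ e → sym (inverseˡ (sym e))) , inverseʳ

  colouring-balanced : ∀ n → Balanced {2 * m} {n} colouring
  colouring-balanced n s s′ = trans (colouring-classSize n s) (sym (colouring-classSize n s′))

  colouring-linePoint-opposite : ∀ {n} (L : LineTemplate (2 * m) n) i →
                                 colouring (linePoint L (opposite i)) ≡ colouring (linePoint L i)
  colouring-linePoint-opposite {n} L i =
    cong (Inverse.from (digits n)) (map-linePoint-opposite fold fold-opposite L i)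

theorem3 : (t m n : ℕ) → t ≡ 2 * m → t ≥ 4 → n ≥ 1 →
    Σ (Point t n → Fin (m ^ n)) λ f →
      IsColoring t n (m ^ n) f × Balanced f ×
      ((L : LineTemplate t n) → IsGeometricLine L → ¬ Rainbow f L)
theorem3 .(2 * zero) zero n refl () _
theorem3 .(2 * suc k) (suc k) n refl _ _ =
    colouring
  , colouring-surjective n
  , colouring-balanced n
  , λ L _ rainbow → opposite-≢ {suc k} Fin.zero (rainbow (colouring-linePoint-opposite L Fin.zero))
  where open FoldColouring (suc k)
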